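{- If $G$ is a finite, simple, connected, uniquely dimensional graph of order $n$, then $\beta(G)<\frac{n}{2}$.
   Context: For vertices $u,v$ of a connected graph $G$, $d(u,v)$ is the distance between them. For an ordered set $W=\{w_1,\dots,w_k\}\subseteq V(G)$ and $v\in V(G)$, $r(v|W)=(d(v,w_1),\dots,d(v,w_k))$. $W$ is a resolving set if distinct vertices have distinct representations $r(\cdot|W)$. A resolving set of minimum cardinality is a metric basis; its cardinality is the metric dimension $\beta(G)$. $G$ is uniquely dimensional if it has exactly one metric basis. -}

module Defs where

open import Data.Nat using (ℕ; zero; suc; _≤_)
open import Data.Fin using (Fin)
open import Data.Fin.Subset using (Subset; _∈_; ∣_∣)
open import Data.Product using (Σ; ∃; _×_)
open import Relation.Nullary using (¬_; Dec)
open import Relation.Binary.PropositionalEquality using (_≡_; _≢_)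

record Graph (n : ℕ) : Set₁ where
  field
    Adj     : Fin n → Fin n → Set
    adj-sym : ∀ {u v} → Adj u v → Adj v u
    irrefl  : ∀ {u} → ¬ Adj u u
    adj-dec : ∀ u v → Dec (Adj u v)
open Graph public

data Walk {n : ℕ} (G : Graph n) : Fin n → Fin n → ℕ → Set where
  here : ∀ {u} → Walk G u u zero
  step : ∀ {u v w k} → Adj G u v → Walk G v w k → Walk G u w (suc k)

Dist : ∀ {n} → Graph n → Fin n → Fin n → ℕ → Set
Dist G u v k = Walk G u v k × (∀ m → Walk G u v m → k ≤ m)

Connected : ∀ {n} → Graph n → Set
Connected G = ∀ u v → ∃ λ k → Walk G u v k

Resolving : ∀ {n} → Graph n → Subset n → Set
Resolving G W = ∀ u v → u ≢ v →
  Σ _ λ w → w ∈ W × Σ ℕ λ k → Dist G u w k × ¬ Dist G v w k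

MetricBasis : ∀ {n} → Graph n → Subset n → Set
MetricBasis G W = Resolving G W × (∀ W' → Resolving G W' → ∣ W ∣ ≤ ∣ W' ∣)

UniquelyDimensional : ∀ {n} → Graph n → Set
UniquelyDimensional G = Σ _ λ B → MetricBasis G B × (∀ B' → MetricBasis G B' → B' ≡ B)

-- Let B be the unique metric basis and suppose basis vertices x ≠ y have the
-- same distance to every vertex outside B. Put R = B - x. Any vertex v ∉ B that
-- R does not separate from x has d(v, x) = d(v, y) = d(x, y), so its distances
-- to all of B are determined, and B forces there to be at most one such v.
-- If there is none, R resolves G, contradicting minimality; if there is one, q,
-- then R ∪ ⁅ q ⁆ is a second metric basis. Hence ∁ B separates any two vertices
-- of B and so resolves G; were 2 ∣ B ∣ ≥ n, it would be a metric basis ≠ B.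
module Submission where

open import Defs
open import Data.Bool using (true; false)
open import Data.Bool.Properties using (not-¬)
open import Data.Empty using (⊥; ⊥-elim)
open import Data.Fin using (Fin)
open import Data.Fin.Properties using (any?) renaming (_≟_ to _≟ᶠ_)
open import Data.Fin.Subset
  using (Subset; _∈_; _∉_; _⊆_; _-_; _∪_; ∁; ⁅_⁆; ∣_∣)
open import Data.Fin.Subset.Properties
  using (_∈?_; x∈p∧x≢y⇒x∈p-y; x∈p⇒∣p-x∣<∣p∣; x∉p⇒x∈∁p; x∈⁅x⁆; ∣⁅x⁆∣≡1;
         p⊆p∪q; q⊆p∪q; ∣∁p∣≡n∸∣p∣)
open import Data.Nat using (ℕ; zero; suc; _+_; _∸_; _*_; _≤_; _<_; z≤n; s≤s; _<?_)
open import Data.Nat.Properties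
open import Data.Product using (Σ; ∃; _×_; _,_; proj₁; proj₂)
open import Data.Sum using (_⊎_; inj₁; inj₂)
open import Data.Vec using (_∷_; []; head)
open import Relation.Nullary using (¬_; Dec; yes; no; contradiction)
open import Relation.Nullary.Decidable using (_×-dec_; ¬?)
open import Relation.Unary using (Decidable)
open import Relation.Binary.PropositionalEquality

∣p∪q∣≤∣p∣+∣q∣ : ∀ {n} (p q : Subset n) → ∣ p ∪ q ∣ ≤ ∣ p ∣ + ∣ q ∣
∣p∪q∣≤∣p∣+∣q∣ []          []          = z≤n
∣p∪q∣≤∣p∣+∣q∣ (true ∷ p)  (true ∷ q)  =
  s≤s (≤-trans (∣p∪q∣≤∣p∣+∣q∣ p q) (+-monoʳ-≤ ∣ p ∣ (n≤1+n ∣ q ∣)))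
∣p∪q∣≤∣p∣+∣q∣ (true ∷ p)  (false ∷ q) = s≤s (∣p∪q∣≤∣p∣+∣q∣ p q)
∣p∪q∣≤∣p∣+∣q∣ (false ∷ p) (true ∷ q)  =
  ≤-trans (s≤s (∣p∪q∣≤∣p∣+∣q∣ p q)) (≤-reflexive (sym (+-suc ∣ p ∣ ∣ q ∣)))
∣p∪q∣≤∣p∣+∣q∣ (false ∷ p) (false ∷ q) = ∣p∪q∣≤∣p∣+∣q∣ p q

∣p-x∪⁅y⁆∣≤∣p∣ : ∀ {n} {x : Fin n} (p : Subset n) (y : Fin n) → x ∈ p → ∣ (p - x) ∪ ⁅ y ⁆ ∣ ≤ ∣ p ∣
∣p-x∪⁅y⁆∣≤∣p∣ {x = x} p y x∈p = begin
  ∣ (p - x) ∪ ⁅ y ⁆ ∣   ≤⟨ ∣p∪q∣≤∣p∣+∣q∣ (p - x) ⁅ y ⁆ ⟩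
  ∣ p - x ∣ + ∣ ⁅ y ⁆ ∣ ≡⟨ cong (∣ p - x ∣ +_) (∣⁅x⁆∣≡1 y) ⟩
  ∣ p - x ∣ + 1         ≡⟨ +-comm ∣ p - x ∣ 1 ⟩
  suc ∣ p - x ∣         ≤⟨ x∈p⇒∣p-x∣<∣p∣ x∈p ⟩
  ∣ p ∣                 ∎
  where open ≤-Reasoning

x∉p-y⇒x≡y⊎x∉p : ∀ {n} {x y : Fin n} {p : Subset n} → x ∉ p - y → x ≡ y ⊎ x ∉ p
x∉p-y⇒x≡y⊎x∉p {x = x} {y} {p} x∉p-y with x ≟ᶠ y
... | yes x≡y = inj₁ x≡y
... | no  x≢y = inj₂ λ x∈p → x∉p-y (x∈p∧x≢y⇒x∈p-y x∈p x≢y)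

∁p≢p : ∀ {n} (p : Subset (suc n)) → ∁ p ≢ p
∁p≢p (b ∷ p) ∁p≡p = not-¬ refl (sym (cong head ∁p≡p))

module _ {P : ℕ → Set} (P? : Decidable P) where

  Least : ℕ → Set
  Least m = P m × (∀ j → P j → m ≤ j)

  private
    none-below⇒least : ∀ {i} → (∀ j → j < i → ¬ P j) → P i → Least i
    none-below⇒least none<i Pi = Pi , λ j Pj → ≮⇒≥ λ j<i → none<i j j<i Pj

    least-from : ∀ i d → (∀ j → j < i → ¬ P j) → P (d + i) → ∃ Least
    least-from i zero    none<i Pi = i , none-below⇒least none<i Pi
    least-from i (suc d) none<i Pd+i with P? i
    ... | yes Pi = i , none-below⇒least none<i Pi
    ... | no ¬Pi = least-from (suc i) d none<1+i (subst P (sym (+-suc d i)) Pd+i)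
      where
      none<1+i : ∀ j → j < suc i → ¬ P j
      none<1+i j j<1+i with m<1+n⇒m<n∨m≡n j<1+i
      ... | inj₁ j<i  = none<i j j<i
      ... | inj₂ refl = ¬Pi

  least : ∀ {k} → P k → ∃ Least
  least {k} Pk = least-from 0 k (λ _ ()) (subst P (sym (+-identityʳ k)) Pk)

module Distance {n} (G : Graph n) (connected : Connected G) where

  snoc : ∀ {u v w k} → Walk G u v k → Adj G v w → Walk G u w (suc k)
  snoc here       v~w = step v~w here
  snoc (step a p) v~w = step a (snoc p v~w)

  reverse : ∀ {u v k} → Walk G u v k → Walk G v u k
  reverse here         = here
  reverse (step u~v p) = snoc (reverse p) (adj-sym G u~v)

  walk? : ∀ u v k → Dec (Walk G u v k)
  walk? u v zero with u ≟ᶠ v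
  ... | yes refl = yes here
  ... | no  u≢v  = no λ { here → u≢v refl }
  walk? u v (suc k) with any? (λ w → adj-dec G u w ×-dec walk? w v k)
  ... | yes (w , u~w , p) = yes (step u~w p)
  ... | no  ¬p            = no λ { (step u~w p) → ¬p (_ , u~w , p) }

  shortest : ∀ u v → ∃ (Dist G u v)
  shortest u v = least (walk? u v) (proj₂ (connected u v))

  dist : Fin n → Fin n → ℕ
  dist u v = proj₁ (shortest u v)

  dist-spec : ∀ u v → Dist G u v (dist u v)
  dist-spec u v = proj₂ (shortest u v)

  Dist⇒≡dist : ∀ {u v k} → Dist G u v k → k ≡ dist u v
  Dist⇒≡dist {u} {v} (p , p-min) =
    ≤-antisym (p-min _ (proj₁ (dist-spec u v))) (proj₂ (dist-spec u v) _ p)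

  dist-sym : ∀ u v → dist u v ≡ dist v u
  dist-sym u v = Dist⇒≡dist (reverse p , λ m q → p-min m (reverse q))
    where
    p = proj₁ (dist-spec u v)
    p-min = proj₂ (dist-spec u v)

  dist-self : ∀ u → dist u u ≡ 0
  dist-self u = sym (Dist⇒≡dist (here , λ _ _ → z≤n))

  dist≡0⇒≡ : ∀ {u v} → dist u v ≡ 0 → u ≡ v
  dist≡0⇒≡ {u} {v} d≡0 with subst (Walk G u v) d≡0 (proj₁ (dist-spec u v))
  ... | here = refl

  Separates : Subset n → Fin n → Fin n → Set
  Separates W u v = Σ (Fin n) λ w → w ∈ W × dist u w ≢ dist v w

  Resolves : Subset n → Set
  Resolves W = ∀ u v → u ≢ v → Separates W u v

  separates-sym : ∀ {W u v} → Separates W u v → Separates W v u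
  separates-sym (w , w∈W , ne) = w , w∈W , ≢-sym ne

  separates-self : ∀ {W u v} → u ∈ W → u ≢ v → Separates W u v
  separates-self {u = u} u∈W u≢v = u , u∈W , λ eq →
    u≢v (sym (dist≡0⇒≡ (trans (sym eq) (dist-self u))))

  separates? : ∀ W u v → Dec (Separates W u v)
  separates? W u v = any? λ w → (w ∈? W) ×-dec ¬? (dist u w ≟ dist v w)

  ¬separates⇒dist≡ : ∀ {W u v} → ¬ Separates W u v → ∀ w → w ∈ W → dist u w ≡ dist v w
  ¬separates⇒dist≡ {u = u} {v} ¬sep w w∈W with dist u w ≟ dist v w
  ... | yes eq = eq
  ... | no  ne = contradiction (w , w∈W , ne) ¬sep

  resolves⇒Resolving : ∀ {W} → Resolves W → Resolving G W
  resolves⇒Resolving res u v u≢v with res u v u≢v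
  ... | w , w∈W , ne = w , w∈W , dist u w , dist-spec u w , λ d → ne (Dist⇒≡dist d)

  Resolving⇒resolves : ∀ {W} → Resolving G W → Resolves W
  Resolving⇒resolves res u v u≢v with res u v u≢v
  ... | w , w∈W , k , d , ¬d = w , w∈W , λ eq →
    ¬d (subst (Dist G v w) (trans (sym eq) (sym (Dist⇒≡dist d))) (dist-spec v w))

  resolves-injective : ∀ {W u v} → Resolves W → (∀ w → w ∈ W → dist u w ≡ dist v w) → u ≡ v
  resolves-injective {u = u} {v} res same with u ≟ᶠ v
  ... | yes u≡v = u≡v
  ... | no  u≢v = let w , w∈W , ne = res u v u≢v in contradiction (same w w∈W) ne

  module UniqueBasis (B : Subset n) (basis : MetricBasis G B)
                     (unique : ∀ B′ → MetricBasis G B′ → B′ ≡ B) where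

    resB : Resolves B
    resB = Resolving⇒resolves (proj₁ basis)

    small-resolving⇒≡B : ∀ {S} → Resolves S → ∣ S ∣ ≤ ∣ B ∣ → S ≡ B
    small-resolving⇒≡B res ∣S∣≤∣B∣ = unique _
      (resolves⇒Resolving res , λ W resW → ≤-trans ∣S∣≤∣B∣ (proj₂ basis W resW))

    module Twins (x y : Fin n) (x∈B : x ∈ B) (y∈B : y ∈ B) (x≢y : x ≢ y)
                 (twins : ∀ z → z ∉ B → dist x z ≡ dist y z) where

      R : Subset n
      R = B - x

      y∈R : y ∈ R
      y∈R = x∈p∧x≢y⇒x∈p-y y∈B (≢-sym x≢y)

      outside-x≡y : ∀ {v} → v ∉ B → dist v x ≡ dist v y
      outside-x≡y {v} v∉B = begin
        dist v x ≡⟨ dist-sym v x ⟩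
        dist x v ≡⟨ twins v v∉B ⟩
        dist y v ≡⟨ dist-sym y v ⟩
        dist v y ∎
        where open ≡-Reasoning

      outsiders-separated : ∀ {u v} → u ∉ B → v ∉ B → u ≢ v → Separates R u v
      outsiders-separated {u} {v} u∉B v∉B u≢v with resB u v u≢v
      ... | w , w∈B , ne with w ≟ᶠ x
      ...   | no  w≢x  = w , x∈p∧x≢y⇒x∈p-y w∈B w≢x , ne
      ...   | yes refl = y , y∈R , λ eq →
        ne (trans (outside-x≡y u∉B) (trans eq (sym (outside-x≡y v∉B))))

      resolves-if-separates-x : ∀ {S} → R ⊆ S →
        (∀ {v} → v ∉ B → Separates S x v) → Resolves S
      resolves-if-separates-x R⊆S separate-x u v u≢v with u ∈? R | v ∈? R
      ... | yes u∈R | _     = separates-self (R⊆S u∈R) u≢v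
      ... | no  _   | yes v∈R = separates-sym (separates-self (R⊆S v∈R) (≢-sym u≢v))
      ... | no  u∉R | no  v∉R with x∉p-y⇒x≡y⊎x∉p u∉R | x∉p-y⇒x≡y⊎x∉p v∉R
      ...   | inj₁ refl | inj₁ refl = contradiction refl u≢v
      ...   | inj₁ refl | inj₂ v∉B  = separate-x v∉B
      ...   | inj₂ u∉B  | inj₁ refl = separates-sym (separate-x u∉B)
      ...   | inj₂ u∉B  | inj₂ v∉B  =
        let w , w∈R , ne = outsiders-separated u∉B v∉B u≢v in w , R⊆S w∈R , ne

      unseparated-from-x-unique : ∀ {u v} → u ∉ B → v ∉ B →
        ¬ Separates R x u → ¬ Separates R x v → u ≡ v
      unseparated-from-x-unique {u} {v} u∉B v∉B u~x v~x = resolves-injective resB same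
        where
        same : ∀ w → w ∈ B → dist u w ≡ dist v w
        same w w∈B with w ≟ᶠ x
        ... | no  w≢x  = let w∈R = x∈p∧x≢y⇒x∈p-y w∈B w≢x in
          trans (sym (¬separates⇒dist≡ u~x w w∈R)) (¬separates⇒dist≡ v~x w w∈R)
        ... | yes refl = begin
          dist u x ≡⟨ outside-x≡y u∉B ⟩
          dist u y ≡⟨ trans (sym (¬separates⇒dist≡ u~x y y∈R)) (¬separates⇒dist≡ v~x y y∈R) ⟩
          dist v y ≡⟨ outside-x≡y v∉B ⟨
          dist v x ∎
          where open ≡-Reasoning

      R-not-resolving : ¬ Resolves R
      R-not-resolving resR = <⇒≱ (x∈p⇒∣p-x∣<∣p∣ x∈B) (proj₂ basis R (resolves⇒Resolving resR))

      no-unseparated-outsider : ∀ {q} → q ∉ B → ¬ ¬ Separates R x q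
      no-unseparated-outsider {q} q∉B q~x = q∉B (subst (q ∈_) S≡B q∈S)
        where
        S : Subset n
        S = R ∪ ⁅ q ⁆

        q∈S : q ∈ S
        q∈S = q⊆p∪q R ⁅ q ⁆ (x∈⁅x⁆ q)

        R⊆S : R ⊆ S
        R⊆S = p⊆p∪q ⁅ q ⁆

        separates-x : ∀ {v} → v ∉ B → Separates S x v
        separates-x {v} v∉B with separates? R x v
        ... | yes (w , w∈R , ne) = w , R⊆S w∈R , ne
        ... | no  v~x with unseparated-from-x-unique v∉B q∉B v~x q~x
        ...   | refl = separates-sym (separates-self q∈S λ { refl → q∉B x∈B })

        S≡B : S ≡ B
        S≡B = small-resolving⇒≡B (resolves-if-separates-x R⊆S separates-x)
                                 (∣p-x∪⁅y⁆∣≤∣p∣ B q x∈B)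

      impossible : ⊥
      impossible = R-not-resolving (resolves-if-separates-x (λ w∈R → w∈R) separates-x)
        where
        separates-x : ∀ {v} → v ∉ B → Separates R x v
        separates-x {v} v∉B with separates? R x v
        ... | yes sep = sep
        ... | no ¬sep = contradiction ¬sep (no-unseparated-outsider v∉B)

    separated-outside : ∀ {x y} → x ∈ B → y ∈ B → x ≢ y → Separates (∁ B) x y
    separated-outside {x} {y} x∈B y∈B x≢y with separates? (∁ B) x y
    ... | yes sep = sep
    ... | no ¬sep = ⊥-elim (Twins.impossible x y x∈B y∈B x≢y twins)
      where
      twins : ∀ z → z ∉ B → dist x z ≡ dist y z
      twins z z∉B = ¬separates⇒dist≡ ¬sep z (x∉p⇒x∈∁p z∉B)

    complement-resolves : Resolves (∁ B)
    complement-resolves u v u≢v with u ∈? B | v ∈? B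
    ... | no  u∉B | _       = separates-self (x∉p⇒x∈∁p u∉B) u≢v
    ... | yes _   | no  v∉B = separates-sym (separates-self (x∉p⇒x∈∁p v∉B) (≢-sym u≢v))
    ... | yes u∈B | yes v∈B = separated-outside u∈B v∈B u≢v

uniquely-dimensional⇒basis-unique : ∀ {n} {G : Graph n} → UniquelyDimensional G →
  ∀ {B} → MetricBasis G B → ∀ B′ → MetricBasis G B′ → B′ ≡ B
uniquely-dimensional⇒basis-unique (_ , _ , unique₀) basis B′ basis′ =
  trans (unique₀ B′ basis′) (sym (unique₀ _ basis))

n≤2m⇒n∸m≤m : ∀ {n m} → n ≤ 2 * m → n ∸ m ≤ m
n≤2m⇒n∸m≤m {n} {m} n≤2m =
  m≤n+o⇒m∸n≤o n m (≤-trans n≤2m (≤-reflexive (cong (m +_) (+-identityʳ m))))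

theorem3 : (n : ℕ) → 1 ≤ n → (G : Graph n) → Connected G → UniquelyDimensional G →
    (B : Subset n) → MetricBasis G B → 2 * ∣ B ∣ < n
theorem3 (suc n) _ G connected uniquely B basis with 2 * ∣ B ∣ <? suc n
... | yes 2∣B∣<n = 2∣B∣<n
... | no  2∣B∣≮n = contradiction (small-resolving⇒≡B complement-resolves ∣∁B∣≤∣B∣) (∁p≢p B)
  where
  open Distance G connected
  open UniqueBasis B basis (uniquely-dimensional⇒basis-unique uniquely basis)

  ∣∁B∣≤∣B∣ : ∣ ∁ B ∣ ≤ ∣ B ∣
  ∣∁B∣≤∣B∣ = ≤-trans (≤-reflexive (∣∁p∣≡n∸∣p∣ B)) (n≤2m⇒n∸m≤m (≮⇒≥ 2∣B∣≮n))
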